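{- Let $\chi$ be a CC coloring of $K_n$, and let $F$ be a forest on $n$ vertices with $3\mid e(F)$ such that either $F$ has, for each $i\in\{0,1,2\}$, a vertex of degree $\equiv i \pmod 3$, or $F$ has at least two vertices of degree $\equiv 0 \pmod 3$. Then $K_n$ contains a copy of $F$ whose edge colors sum to $0$ in $\mathbb{Z}_3$.
   Context: A coloring $\chi:E(K_N)\to\mathbb{Z}_3$ is a CC coloring if $V(K_N)$ can be partitioned into three (possibly empty) sets $V_0,V_1,V_2$ such that for each $i\in\{0,1,2\}$ the edges of color $i$ are exactly the edges inside $V_i$ together with the edges joining $V_{i+1}$ and $V_{i+2}$ (indices modulo $3$). A copy of $F$ is a subgraph isomorphic to $F$; isolated vertices of $F$ (degree $0$) are allowed. -}

module Defs where

open import Data.Nat using (ℕ; zero; suc; _<ᵇ_; _%_; _+_)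
open import Data.Fin using (Fin; zero; suc; toℕ; inject₁; fromℕ)
open import Data.Bool using (Bool; true; false; _∧_)
open import Data.List using (List; length; map; allFin; concatMap; filterᵇ)
open import Data.Nat.ListAction using (sum)
open import Data.Product using (_×_; _,_; Σ; ∃; ∃-syntax)
open import Data.Sum using (_⊎_)
open import Relation.Binary.PropositionalEquality using (_≡_; _≢_)
open import Relation.Nullary using (¬_)
open import Function.Definitions using (Injective)

suc₃ : Fin 3 → Fin 3
suc₃ zero = suc zero
suc₃ (suc zero) = suc (suc zero)
suc₃ (suc (suc zero)) = zero

-- An edge colouring of K_N with colours in ℤ₃: a colour for every ordered pair;
-- only pairs of distinct vertices are meaningful.
Coloring : ℕ → Set
Coloring N = Fin N → Fin N → Fin 3

-- CC colouring: there is a partition V₀,V₁,V₂ (given by p : vertex ↦ part index)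
-- such that for each i, the edges of colour i are exactly the edges inside V_i
-- together with the edges between V_{i+1} and V_{i+2}.
IsCC : ∀ {N} → Coloring N → Set
IsCC {N} χ = Σ (Fin N → Fin 3) λ p →
  ∀ (u v : Fin N) → u ≢ v → ∀ (i : Fin 3) →
    (χ u v ≡ i →
       (p u ≡ i × p v ≡ i) ⊎ (p u ≡ suc₃ i × p v ≡ suc₃ (suc₃ i))
                           ⊎ (p u ≡ suc₃ (suc₃ i) × p v ≡ suc₃ i))
  × ((p u ≡ i × p v ≡ i) ⊎ (p u ≡ suc₃ i × p v ≡ suc₃ (suc₃ i))
                         ⊎ (p u ≡ suc₃ (suc₃ i) × p v ≡ suc₃ i) →
       χ u v ≡ i)

record Graph (n : ℕ) : Set where
  field
    adj   : Fin n → Fin n → Bool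
    sym   : ∀ u v → adj u v ≡ adj v u
    loopless : ∀ u → adj u u ≡ false
open Graph public

pairs : ∀ n → List (Fin n × Fin n)
pairs n = concatMap (λ u → map (λ v → (u , v)) (allFin n)) (allFin n)

edges : ∀ {n} → Graph n → List (Fin n × Fin n)
edges {n} F = filterᵇ (λ { (u , v) → (toℕ u <ᵇ toℕ v) ∧ adj F u v }) (pairs n)

numEdges : ∀ {n} → Graph n → ℕ
numEdges F = length (edges F)

degree : ∀ {n} → Graph n → Fin n → ℕ
degree {n} F v = length (filterᵇ (adj F v) (allFin n))

IsCycle : ∀ {n} → Graph n → (k : ℕ) → (Fin (3 + k) → Fin n) → Set
IsCycle F k c =
  Injective _≡_ _≡_ c
  × (∀ (i : Fin (2 + k)) → adj F (c (inject₁ i)) (c (suc i)) ≡ true)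
  × adj F (c (fromℕ (2 + k))) (c zero) ≡ true

IsForest : ∀ {n} → Graph n → Set
IsForest F = ∀ (k : ℕ) (c : Fin (3 + k) → Fin _) → ¬ IsCycle F k c

-- Sum (in ℤ₃, via ℕ mod 3) of the colours of the copy of F given by the
-- embedding σ : V(F) → V(K_N), i.e. of the edges σ(u)σ(v), uv ∈ E(F).
copyColorSum : ∀ {n} → Coloring n → Graph n → (Fin n → Fin n) → ℕ
copyColorSum χ F σ = sum (map (λ { (u , v) → toℕ (χ (σ u) (σ v)) }) (edges F)) % 3

{-# OPTIONS --safe #-}
module Submission where

-- Let p be the part function of the CC colouring.  Every edge uv gets colour −(p u + p v), so
-- the colour sum of the copy σ(F) is −Σ_w deg(w)·p(σ w) in ℤ₃ by the handshake identity, and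
-- Σ_w deg(w) = 2e(F) ≡ 0.  It remains to rearrange the labels ℓ = p by a permutation so that
-- the weight Σ_w d(w)·ℓ(w), with d = deg mod 3, vanishes.  Transposing u and v changes the
-- weight by (d u − d v)(ℓ v − ℓ u), and the weight is already 0 when ℓ is constant where d ≠ 0.
-- With two vertices of d = 0 one finds two disjoint transpositions with nonzero changes δ₁, δ₂;
-- then 0, δ₁, δ₂, δ₁ + δ₂ cover ℤ₃.  With d = 0, 1, 2 at a, b, c one arranges, by at most two
-- preliminary transpositions, that a label is shared by two of a, b, c but not the third; the
-- two transpositions moving the odd label then give distinct nonzero changes.  This uses a
-- fourth vertex, which exists because on three vertices 3 ∣ e(F) excludes the degree pattern.

open import Algebra.Bundles using (CommutativeSemiring)
open import Algebra.Structures.Biased using (isCommutativeSemiringˡ; isCommutativeMonoidˡ)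
open import Data.Bool using (Bool; true; false; if_then_else_; _∧_; T)
open import Data.Bool.Properties using (∧-zeroʳ)
open import Data.Fin using (Fin; zero; suc; toℕ)
open import Data.Fin.Patterns using (0F; 1F; 2F)
open import Data.Fin.Permutation using (Permutation′; _⟨$⟩ʳ_; _∘ₚ_; transpose) renaming (id to idₚ)
open import Data.Fin.Properties using (_≟_; all?; any?; toℕ-fromℕ<; toℕ-injective; suc-injective; injective⇒≤)
open import Data.List using (List; []; _∷_; map; foldr; filterᵇ; allFin; length; concatMap; _++_; tabulate)
open import Data.List.Properties using (map-++; map-∘; map-cong)
open import Data.Nat as ℕ using (ℕ; zero; suc; _%_; _<ᵇ_)
open import Data.Nat.DivMod using (_mod_; %-distribˡ-+)
open import Data.Nat.ListAction using () renaming (sum to sumℕ)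
open import Data.Nat.Properties using (<ᵇ⇒<; <⇒<ᵇ; <-asym; ≮⇒≥; ≤-antisym)
open import Data.Product using (_×_; _,_; ∃; ∃-syntax; Σ; proj₁; proj₂)
open import Data.Sum using (_⊎_; inj₁; inj₂; [_,_]′)
open import Data.Unit using (tt)
open import Function using (_∘_; id)
open import Function.Bundles using (Injection)
open import Function.Definitions using (Injective)
open import Function.Properties.Inverse using (↔⇒↣)
open import Relation.Binary.PropositionalEquality
open import Relation.Binary.PropositionalEquality.Algebra using (isMagma)
open import Relation.Nullary using (yes; no; contradiction)
open import Relation.Nullary.Decidable using (from-yes; ¬?; _×-dec_; _⊎-dec_; _→-dec_; dec-true; dec-false; decidable-stable)

open import Defs renaming (sym to adj-sym)

ℤ₃ : Set
ℤ₃ = Fin 3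

infixl 6 _+_ _-_
infixl 7 _*_
infix  8 -_

[_]₃ : ℕ → ℤ₃
[ m ]₃ = m mod 3

toℕ-[]₃ : ∀ m → toℕ [ m ]₃ ≡ m % 3
toℕ-[]₃ m = toℕ-fromℕ< _

[]₃-from-% : ∀ m {a} → m % 3 ≡ toℕ a → [ m ]₃ ≡ a
[]₃-from-% m m%3≡a = toℕ-injective (trans (toℕ-[]₃ m) m%3≡a)

[toℕ]₃ : ∀ a → [ toℕ a ]₃ ≡ a
[toℕ]₃ = from-yes (all? λ a → [ toℕ a ]₃ ≟ a)

-- Opaque, so that unification sees the ℤ₃ operations instead of their unfoldings into ℕ.
opaque
  _+_ _*_ : ℤ₃ → ℤ₃ → ℤ₃
  a + b = [ toℕ a ℕ.+ toℕ b ]₃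
  a * b = [ toℕ a ℕ.* toℕ b ]₃

  -_ : ℤ₃ → ℤ₃
  - a = [ 2 ℕ.* toℕ a ]₃

_-_ : ℤ₃ → ℤ₃ → ℤ₃
a - b = a + - b

opaque
  unfolding _+_ _*_ -_

  +-assoc : ∀ a b c → (a + b) + c ≡ a + (b + c)
  +-assoc = from-yes (all? λ a → all? λ b → all? λ c → (a + b) + c ≟ a + (b + c))

  +-identityˡ : ∀ a → 0F + a ≡ a
  +-identityˡ = from-yes (all? λ a → 0F + a ≟ a)

  +-comm : ∀ a b → a + b ≡ b + a
  +-comm = from-yes (all? λ a → all? λ b → a + b ≟ b + a)

  *-assoc : ∀ a b c → (a * b) * c ≡ a * (b * c)
  *-assoc = from-yes (all? λ a → all? λ b → all? λ c → (a * b) * c ≟ a * (b * c))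

  *-identityˡ : ∀ a → 1F * a ≡ a
  *-identityˡ = from-yes (all? λ a → 1F * a ≟ a)

  *-comm : ∀ a b → a * b ≡ b * a
  *-comm = from-yes (all? λ a → all? λ b → a * b ≟ b * a)

  *-distribʳ-+ : ∀ a b c → (b + c) * a ≡ b * a + c * a
  *-distribʳ-+ = from-yes (all? λ a → all? λ b → all? λ c → (b + c) * a ≟ b * a + c * a)

  *-zeroˡ : ∀ a → 0F * a ≡ 0F
  *-zeroˡ = from-yes (all? λ a → 0F * a ≟ 0F)

  -0≡0 : - 0F ≡ 0F
  -0≡0 = refl

  -‿+-distrib : ∀ a b → - (a + b) ≡ - a + - b
  -‿+-distrib = from-yes (all? λ a → all? λ b → - (a + b) ≟ - a + - b)

  x-x≡0 : ∀ x → x - x ≡ 0F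
  x-x≡0 = from-yes (all? λ x → x - x ≟ 0F)

  y+[x-y]≡x : ∀ x y → y + (x - y) ≡ x
  y+[x-y]≡x = from-yes (all? λ x → all? λ y → y + (x - y) ≟ x)

  a*[y-x]+b*[x-y]≡[a-b]*[y-x] : ∀ a b x y → a * (y - x) + b * (x - y) ≡ (a - b) * (y - x)
  a*[y-x]+b*[x-y]≡[a-b]*[y-x] = from-yes (all? λ a → all? λ b → all? λ x → all? λ y →
    a * (y - x) + b * (x - y) ≟ (a - b) * (y - x))

  x≢y⇒x-y≢0 : ∀ {x y} → x ≢ y → x - y ≢ 0F
  x≢y⇒x-y≢0 {x} {y} = from-yes (all? λ x → all? λ y → ¬? (x ≟ y) →-dec ¬? (x - y ≟ 0F)) x y

  x≢0∧y≢0⇒x*y≢0 : ∀ {x y} → x ≢ 0F → y ≢ 0F → x * y ≢ 0F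
  x≢0∧y≢0⇒x*y≢0 {x} {y} = from-yes (all? λ x → all? λ y →
    ¬? (x ≟ 0F) →-dec ¬? (y ≟ 0F) →-dec ¬? (x * y ≟ 0F)) x y

  *-cancelʳ-≢ : ∀ {x y c} → c ≢ 0F → x ≢ y → x * c ≢ y * c
  *-cancelʳ-≢ {x} {y} {c} = from-yes (all? λ x → all? λ y → all? λ c →
    ¬? (c ≟ 0F) →-dec ¬? (x ≟ y) →-dec ¬? (x * c ≟ y * c)) x y c

  -‿cancelʳ-≢ : ∀ {x y z} → x ≢ y → x - z ≢ y - z
  -‿cancelʳ-≢ {x} {y} {z} = from-yes (all? λ x → all? λ y → all? λ z →
    ¬? (x ≟ y) →-dec ¬? (x - z ≟ y - z)) x y z

  []₃-+ : ∀ m n → [ m ℕ.+ n ]₃ ≡ [ m ]₃ + [ n ]₃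
  []₃-+ m n = toℕ-injective (begin
    toℕ [ m ℕ.+ n ]₃                 ≡⟨ toℕ-[]₃ (m ℕ.+ n) ⟩
    (m ℕ.+ n) % 3                    ≡⟨ %-distribˡ-+ m n 3 ⟩
    (m % 3 ℕ.+ n % 3) % 3            ≡⟨ cong₂ (λ x y → (x ℕ.+ y) % 3) (toℕ-[]₃ m) (toℕ-[]₃ n) ⟨
    (toℕ [ m ]₃ ℕ.+ toℕ [ n ]₃) % 3  ≡⟨ toℕ-[]₃ (toℕ [ m ]₃ ℕ.+ toℕ [ n ]₃) ⟨
    toℕ ([ m ]₃ + [ n ]₃)            ∎)
    where open ≡-Reasoning

  cover-by-two : ∀ t {δ₁ δ₂} → δ₁ ≢ 0F → δ₂ ≢ 0F → δ₁ ≢ δ₂ →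
                 t ≡ 0F ⊎ t + δ₁ ≡ 0F ⊎ t + δ₂ ≡ 0F
  cover-by-two t {δ₁} {δ₂} = from-yes (all? λ t → all? λ δ₁ → all? λ δ₂ →
    ¬? (δ₁ ≟ 0F) →-dec ¬? (δ₂ ≟ 0F) →-dec ¬? (δ₁ ≟ δ₂) →-dec
    (t ≟ 0F ⊎-dec t + δ₁ ≟ 0F ⊎-dec t + δ₂ ≟ 0F)) t δ₁ δ₂

  cover-by-two-and-sum : ∀ t {δ₁ δ₂} → δ₁ ≢ 0F → δ₂ ≢ 0F →
                         t ≡ 0F ⊎ t + δ₁ ≡ 0F ⊎ t + δ₂ ≡ 0F ⊎ t + δ₁ + δ₂ ≡ 0F
  cover-by-two-and-sum t {δ₁} {δ₂} = from-yes (all? λ t → all? λ δ₁ → all? λ δ₂ →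
    ¬? (δ₁ ≟ 0F) →-dec ¬? (δ₂ ≟ 0F) →-dec
    (t ≟ 0F ⊎-dec t + δ₁ ≟ 0F ⊎-dec t + δ₂ ≟ 0F ⊎-dec t + δ₁ + δ₂ ≟ 0F)) t δ₁ δ₂

  -- In a CC colouring, an edge between parts x and y has colour −(x + y).
  parts-of-colour : ∀ x y → let i = - (x + y) in
    (x ≡ i × y ≡ i) ⊎ (x ≡ suc₃ i × y ≡ suc₃ (suc₃ i)) ⊎ (x ≡ suc₃ (suc₃ i) × y ≡ suc₃ i)
  parts-of-colour = from-yes (all? λ x → all? λ y → let i = - (x + y) in
    (x ≟ i ×-dec y ≟ i) ⊎-dec (x ≟ suc₃ i ×-dec y ≟ suc₃ (suc₃ i)) ⊎-dec (x ≟ suc₃ (suc₃ i) ×-dec y ≟ suc₃ i))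

distinct-exhaust : ∀ {x y z} → x ≢ y → x ≢ z → y ≢ z → ∀ w → w ≡ x ⊎ w ≡ y ⊎ w ≡ z
distinct-exhaust {x} {y} {z} = from-yes (all? λ (x : ℤ₃) → all? λ y → all? λ z →
  ¬? (x ≟ y) →-dec ¬? (x ≟ z) →-dec ¬? (y ≟ z) →-dec all? λ w → w ≟ x ⊎-dec w ≟ y ⊎-dec w ≟ z) x y z

+-*-commutativeSemiring : CommutativeSemiring _ _
+-*-commutativeSemiring = record
  { _+_ = _+_
  ; _*_ = _*_
  ; 0#  = 0F
  ; 1#  = 1F
  ; isCommutativeSemiring = isCommutativeSemiringˡ record
    { +-isCommutativeMonoid = isCommutativeMonoidˡ record
      { isSemigroup = record { isMagma = isMagma _+_ ; assoc = +-assoc }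
      ; identityˡ   = +-identityˡ
      ; comm        = +-comm
      }
    ; *-isCommutativeMonoid = isCommutativeMonoidˡ record
      { isSemigroup = record { isMagma = isMagma _*_ ; assoc = *-assoc }
      ; identityˡ   = *-identityˡ
      ; comm        = *-comm
      }
    ; distribʳ = *-distribʳ-+
    ; zeroˡ    = *-zeroˡ
    }
  }

open CommutativeSemiring +-*-commutativeSemiring using (+-identityʳ; *-identityʳ; zeroʳ; distribˡ; distribʳ)
open import Algebra.Properties.Semiring.Sum (CommutativeSemiring.semiring +-*-commutativeSemiring)
  using (sum-syntax; ∑-distrib-+; ∑-comm; *-distribʳ-sum; sum-cong-≗; sum-replicate-zero)

∑-point : ∀ {n} {f : Fin n → ℤ₃} {u} → (∀ w → w ≢ u → f w ≡ 0F) → ∑[ w < n ] f w ≡ f u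
∑-point {suc n} {f} {0F} f≡0 = begin
  f 0F + ∑[ w < n ] f (suc w)  ≡⟨ cong (f 0F +_) (sum-cong-≗ λ w → f≡0 (suc w) λ ()) ⟩
  f 0F + ∑[ w < n ] 0F         ≡⟨ cong (f 0F +_) (sum-replicate-zero n) ⟩
  f 0F + 0F                    ≡⟨ +-identityʳ (f 0F) ⟩
  f 0F                         ∎
  where open ≡-Reasoning
∑-point {suc n} {f} {suc u} f≡0 = begin
  f 0F + ∑[ w < n ] f (suc w)  ≡⟨ cong (_+ ∑[ w < n ] f (suc w)) (f≡0 0F λ ()) ⟩
  0F + ∑[ w < n ] f (suc w)    ≡⟨ +-identityˡ _ ⟩
  ∑[ w < n ] f (suc w)         ≡⟨ ∑-point (λ w w≢u → f≡0 (suc w) (w≢u ∘ suc-injective)) ⟩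
  f (suc u)                    ∎
  where open ≡-Reasoning

∑-pair : ∀ {n} {f : Fin n → ℤ₃} {u v} → u ≢ v → (∀ w → w ≢ u → w ≢ v → f w ≡ 0F) →
         ∑[ w < n ] f w ≡ f u + f v
∑-pair {suc n} {f} {0F}    {0F}    u≢v _   = contradiction refl u≢v
∑-pair {suc n} {f} {0F}    {suc v} _   f≡0 =
  cong (f 0F +_) (∑-point λ w w≢v → f≡0 (suc w) (λ ()) (w≢v ∘ suc-injective))
∑-pair {suc n} {f} {suc u} {0F}    _   f≡0 =
  trans (cong (f 0F +_) (∑-point λ w w≢u → f≡0 (suc w) (w≢u ∘ suc-injective) (λ ())))
        (+-comm (f 0F) (f (suc u)))
∑-pair {suc n} {f} {suc u} {suc v} u≢v f≡0 = begin
  f 0F + ∑[ w < n ] f (suc w)  ≡⟨ cong (_+ ∑[ w < n ] f (suc w)) (f≡0 0F (λ ()) (λ ())) ⟩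
  0F + ∑[ w < n ] f (suc w)    ≡⟨ +-identityˡ _ ⟩
  ∑[ w < n ] f (suc w)         ≡⟨ ∑-pair (u≢v ∘ cong suc) (λ w w≢u w≢v →
                                    f≡0 (suc w) (w≢u ∘ suc-injective) (w≢v ∘ suc-injective)) ⟩
  f (suc u) + f (suc v)        ∎
  where open ≡-Reasoning

private
  variable
    A B : Set

sumₗ : List ℤ₃ → ℤ₃
sumₗ = foldr _+_ 0F

⟦_⟧ : Bool → ℤ₃
⟦ b ⟧ = if b then 1F else 0F

[]₃-sumℕ : ∀ ms → [ sumℕ ms ]₃ ≡ sumₗ (map [_]₃ ms)
[]₃-sumℕ []       = refl
[]₃-sumℕ (m ∷ ms) = trans ([]₃-+ m (sumℕ ms)) (cong ([ m ]₃ +_) ([]₃-sumℕ ms))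

sumₗ-++ : (xs ys : List ℤ₃) → sumₗ (xs ++ ys) ≡ sumₗ xs + sumₗ ys
sumₗ-++ []       ys = sym (+-identityˡ _)
sumₗ-++ (x ∷ xs) ys = trans (cong (x +_) (sumₗ-++ xs ys)) (sym (+-assoc x (sumₗ xs) (sumₗ ys)))

sumₗ-neg : ∀ (f : A → ℤ₃) xs → sumₗ (map (λ x → - f x) xs) ≡ - sumₗ (map f xs)
sumₗ-neg f []       = sym -0≡0
sumₗ-neg f (x ∷ xs) = trans (cong (- f x +_) (sumₗ-neg f xs)) (sym (-‿+-distrib (f x) (sumₗ (map f xs))))

sumₗ-const : ∀ c (xs : List A) → sumₗ (map (λ _ → c) xs) ≡ [ length xs ]₃ * c
sumₗ-const c []       = sym (*-zeroˡ c)
sumₗ-const c (x ∷ xs) = begin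
  c + sumₗ (map (λ _ → c) xs)  ≡⟨ cong₂ _+_ (sym (*-identityˡ c)) (sumₗ-const c xs) ⟩
  1F * c + [ length xs ]₃ * c  ≡⟨ *-distribʳ-+ c 1F [ length xs ]₃ ⟨
  (1F + [ length xs ]₃) * c    ≡⟨ cong (_* c) ([]₃-+ 1 (length xs)) ⟨
  [ suc (length xs) ]₃ * c     ∎
  where open ≡-Reasoning

sumₗ-filterᵇ : ∀ (p : A → Bool) f xs → sumₗ (map f (filterᵇ p xs)) ≡ sumₗ (map (λ x → ⟦ p x ⟧ * f x) xs)
sumₗ-filterᵇ p f []       = refl
sumₗ-filterᵇ p f (x ∷ xs) with p x
... | true  = cong₂ _+_ (sym (*-identityˡ (f x))) (sumₗ-filterᵇ p f xs)
... | false = trans (sumₗ-filterᵇ p f xs)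
                (sym (trans (cong (_+ sumₗ (map (λ x → ⟦ p x ⟧ * f x) xs)) (*-zeroˡ (f x))) (+-identityˡ _)))

sumₗ-tabulate : ∀ {n} (f : A → ℤ₃) (g : Fin n → A) → sumₗ (map f (tabulate g)) ≡ ∑[ i < n ] f (g i)
sumₗ-tabulate {n = zero}  f g = refl
sumₗ-tabulate {n = suc n} f g = cong (f (g 0F) +_) (sumₗ-tabulate f (g ∘ suc))

sumₗ-concatMap : ∀ (h : B → ℤ₃) (k : A → List B) xs →
                 sumₗ (map h (concatMap k xs)) ≡ sumₗ (map (λ x → sumₗ (map h (k x))) xs)
sumₗ-concatMap h k []       = refl
sumₗ-concatMap h k (x ∷ xs) = begin
  sumₗ (map h (k x ++ concatMap k xs))                ≡⟨ cong sumₗ (map-++ h (k x) (concatMap k xs)) ⟩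
  sumₗ (map h (k x) ++ map h (concatMap k xs))        ≡⟨ sumₗ-++ (map h (k x)) (map h (concatMap k xs)) ⟩
  sumₗ (map h (k x)) + sumₗ (map h (concatMap k xs))  ≡⟨ cong (sumₗ (map h (k x)) +_) (sumₗ-concatMap h k xs) ⟩
  sumₗ (map h (k x)) + sumₗ (map (λ x → sumₗ (map h (k x))) xs)  ∎
  where open ≡-Reasoning

sumₗ-pairs : ∀ n (h : Fin n × Fin n → ℤ₃) → sumₗ (map h (pairs n)) ≡ ∑[ u < n ] ∑[ v < n ] h (u , v)
sumₗ-pairs n h = begin
  sumₗ (map h (pairs n))
    ≡⟨ sumₗ-concatMap h (λ u → map (u ,_) (allFin n)) (allFin n) ⟩
  sumₗ (map (λ u → sumₗ (map h (map (u ,_) (allFin n)))) (allFin n))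
    ≡⟨ sumₗ-tabulate (λ u → sumₗ (map h (map (u ,_) (allFin n)))) id ⟩
  ∑[ u < n ] sumₗ (map h (map (u ,_) (allFin n)))
    ≡⟨ sum-cong-≗ (λ u → trans (cong sumₗ (sym (map-∘ (allFin n)))) (sumₗ-tabulate (h ∘ (u ,_)) id)) ⟩
  ∑[ u < n ] ∑[ v < n ] h (u , v)  ∎
  where open ≡-Reasoning

-- Colour sums of copies of F

copyColorSum-as-sumₗ : ∀ {n} (χ : Coloring n) (F : Graph n) σ →
  copyColorSum χ F σ ≡ toℕ (sumₗ (map (λ e → χ (σ (proj₁ e)) (σ (proj₂ e))) (edges F)))
copyColorSum-as-sumₗ {n} χ F σ = begin
  sumℕ (map (toℕ ∘ c) (edges F)) % 3            ≡⟨ toℕ-[]₃ (sumℕ (map (toℕ ∘ c) (edges F))) ⟨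
  toℕ [ sumℕ (map (toℕ ∘ c) (edges F)) ]₃       ≡⟨ cong toℕ ([]₃-sumℕ (map (toℕ ∘ c) (edges F))) ⟩
  toℕ (sumₗ (map [_]₃ (map (toℕ ∘ c) (edges F)))) ≡⟨ cong (toℕ ∘ sumₗ) (map-∘ (edges F)) ⟨
  toℕ (sumₗ (map ([_]₃ ∘ toℕ ∘ c) (edges F)))     ≡⟨ cong (toℕ ∘ sumₗ) (map-cong ([toℕ]₃ ∘ c) (edges F)) ⟩
  toℕ (sumₗ (map c (edges F)))                    ∎
  where
  open ≡-Reasoning
  c : Fin n × Fin n → ℤ₃
  c e = χ (σ (proj₁ e)) (σ (proj₂ e))

cc-colour-by-parts : ∀ {N} {χ : Coloring N} → IsCC χ →
                     ∃ λ (p : Fin N → ℤ₃) → ∀ u v → u ≢ v → χ u v ≡ - (p u + p v)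
cc-colour-by-parts (p , cc) = p , λ u v u≢v → proj₂ (cc u v u≢v (- (p u + p v))) (parts-of-colour (p u) (p v))

module _ {n} (F : Graph n) where

  edgeᵇ : Fin n → Fin n → Bool
  edgeᵇ u v = (toℕ u <ᵇ toℕ v) ∧ adj F u v

  sumₗ-edges : ∀ h → sumₗ (map h (edges F)) ≡ ∑[ u < n ] ∑[ v < n ] (⟦ edgeᵇ u v ⟧ * h (u , v))
  sumₗ-edges h = trans (sumₗ-filterᵇ _ h (pairs n)) (sumₗ-pairs n _)

  edgeᵇ-irrefl : ∀ u → edgeᵇ u u ≡ false
  edgeᵇ-irrefl u = trans (cong ((toℕ u <ᵇ toℕ u) ∧_) (loopless F u)) (∧-zeroʳ _)

  sumₗ-edges-cong : ∀ {h h′} → (∀ u v → u ≢ v → h (u , v) ≡ h′ (u , v)) →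
                    sumₗ (map h (edges F)) ≡ sumₗ (map h′ (edges F))
  sumₗ-edges-cong {h} {h′} h≡h′ = begin
    sumₗ (map h (edges F))                                ≡⟨ sumₗ-edges h ⟩
    ∑[ u < n ] ∑[ v < n ] (⟦ edgeᵇ u v ⟧ * h (u , v))       ≡⟨ sum-cong-≗ (λ u → sum-cong-≗ (on-edges u)) ⟩
    ∑[ u < n ] ∑[ v < n ] (⟦ edgeᵇ u v ⟧ * h′ (u , v))      ≡⟨ sumₗ-edges h′ ⟨
    sumₗ (map h′ (edges F))                               ∎
    where
    open ≡-Reasoning
    on-edges : ∀ u v → ⟦ edgeᵇ u v ⟧ * h (u , v) ≡ ⟦ edgeᵇ u v ⟧ * h′ (u , v)
    on-edges u v with u ≟ v
    ... | no u≢v = cong (⟦ edgeᵇ u v ⟧ *_) (h≡h′ u v u≢v)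
    ... | yes refl rewrite edgeᵇ-irrefl u = trans (*-zeroˡ (h (u , u))) (sym (*-zeroˡ (h′ (u , u))))

  adj≡edgeᵇ+edgeᵇ : ∀ u v → ⟦ adj F u v ⟧ ≡ ⟦ edgeᵇ u v ⟧ + ⟦ edgeᵇ v u ⟧
  adj≡edgeᵇ+edgeᵇ u v with toℕ u <ᵇ toℕ v in u<v | toℕ v <ᵇ toℕ u in v<u
  ... | true  | true  = contradiction (<ᵇ⇒< (toℕ u) (toℕ v) (subst T (sym u<v) tt))
                                    (<-asym (<ᵇ⇒< (toℕ v) (toℕ u) (subst T (sym v<u) tt)))
  ... | true  | false = sym (+-identityʳ _)
  ... | false | true  = trans (cong ⟦_⟧ (adj-sym F u v)) (sym (+-identityˡ _))
  adj≡edgeᵇ+edgeᵇ u v | false | false = trans (cong ⟦_⟧ (subst (λ w → adj F u w ≡ false) u≡v (loopless F u)))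
                                              (sym (+-identityˡ 0F))
    where
    u≡v : u ≡ v
    u≡v = toℕ-injective (≤-antisym (≮⇒≥ (subst T v<u ∘ <⇒<ᵇ)) (≮⇒≥ (subst T u<v ∘ <⇒<ᵇ)))

  degree-as-sum : ∀ u → [ degree F u ]₃ ≡ ∑[ v < n ] ⟦ adj F u v ⟧
  degree-as-sum u = begin
    [ degree F u ]₃                                       ≡⟨ *-identityʳ _ ⟨
    [ degree F u ]₃ * 1F                                  ≡⟨ sumₗ-const 1F (filterᵇ (adj F u) (allFin n)) ⟨
    sumₗ (map (λ _ → 1F) (filterᵇ (adj F u) (allFin n)))  ≡⟨ sumₗ-filterᵇ (adj F u) (λ _ → 1F) (allFin n) ⟩
    sumₗ (map (λ v → ⟦ adj F u v ⟧ * 1F) (allFin n))      ≡⟨ sumₗ-tabulate (λ v → ⟦ adj F u v ⟧ * 1F) id ⟩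
    ∑[ v < n ] (⟦ adj F u v ⟧ * 1F)                         ≡⟨ sum-cong-≗ (λ v → *-identityʳ ⟦ adj F u v ⟧) ⟩
    ∑[ v < n ] ⟦ adj F u v ⟧                              ∎
    where open ≡-Reasoning

  handshake : ∀ (f : Fin n → ℤ₃) →
              sumₗ (map (λ e → f (proj₁ e) + f (proj₂ e)) (edges F)) ≡ ∑[ u < n ] ([ degree F u ]₃ * f u)
  handshake f = begin
    sumₗ (map (λ e → f (proj₁ e) + f (proj₂ e)) (edges F))
      ≡⟨ sumₗ-edges _ ⟩
    ∑[ u < n ] ∑[ v < n ] (⟦ edgeᵇ u v ⟧ * (f u + f v))
      ≡⟨ sum-cong-≗ (λ u → trans (sum-cong-≗ λ v → distribˡ ⟦ edgeᵇ u v ⟧ (f u) (f v))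
                                  (∑-distrib-+ (λ v → ⟦ edgeᵇ u v ⟧ * f u) (λ v → ⟦ edgeᵇ u v ⟧ * f v))) ⟩
    ∑[ u < n ] (∑[ v < n ] (⟦ edgeᵇ u v ⟧ * f u) + ∑[ v < n ] (⟦ edgeᵇ u v ⟧ * f v))
      ≡⟨ ∑-distrib-+ (λ u → ∑[ v < n ] (⟦ edgeᵇ u v ⟧ * f u)) (λ u → ∑[ v < n ] (⟦ edgeᵇ u v ⟧ * f v)) ⟩
    ∑[ u < n ] ∑[ v < n ] (⟦ edgeᵇ u v ⟧ * f u) + ∑[ u < n ] ∑[ v < n ] (⟦ edgeᵇ u v ⟧ * f v)
      ≡⟨ cong (∑[ u < n ] ∑[ v < n ] (⟦ edgeᵇ u v ⟧ * f u) +_) (∑-comm (λ u v → ⟦ edgeᵇ u v ⟧ * f v)) ⟩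
    ∑[ u < n ] ∑[ v < n ] (⟦ edgeᵇ u v ⟧ * f u) + ∑[ u < n ] ∑[ v < n ] (⟦ edgeᵇ v u ⟧ * f u)
      ≡⟨ ∑-distrib-+ (λ u → ∑[ v < n ] (⟦ edgeᵇ u v ⟧ * f u)) (λ u → ∑[ v < n ] (⟦ edgeᵇ v u ⟧ * f u)) ⟨
    ∑[ u < n ] (∑[ v < n ] (⟦ edgeᵇ u v ⟧ * f u) + ∑[ v < n ] (⟦ edgeᵇ v u ⟧ * f u))
      ≡⟨ sum-cong-≗ (λ u → trans (sum-cong-≗ λ v → distribʳ (f u) ⟦ edgeᵇ u v ⟧ ⟦ edgeᵇ v u ⟧)
                                  (∑-distrib-+ (λ v → ⟦ edgeᵇ u v ⟧ * f u) (λ v → ⟦ edgeᵇ v u ⟧ * f u))) ⟨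
    ∑[ u < n ] ∑[ v < n ] ((⟦ edgeᵇ u v ⟧ + ⟦ edgeᵇ v u ⟧) * f u)
      ≡⟨ sum-cong-≗ (λ u → sum-cong-≗ λ v → cong (_* f u) (adj≡edgeᵇ+edgeᵇ u v)) ⟨
    ∑[ u < n ] ∑[ v < n ] (⟦ adj F u v ⟧ * f u)
      ≡⟨ sum-cong-≗ (λ u → *-distribʳ-sum (f u) (λ v → ⟦ adj F u v ⟧)) ⟨
    ∑[ u < n ] ((∑[ v < n ] ⟦ adj F u v ⟧) * f u)
      ≡⟨ sum-cong-≗ (λ u → cong (_* f u) (degree-as-sum u)) ⟨
    ∑[ u < n ] ([ degree F u ]₃ * f u)
      ∎
    where open ≡-Reasoning

  degree-sum≡0 : numEdges F % 3 ≡ 0 → ∑[ u < n ] [ degree F u ]₃ ≡ 0F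
  degree-sum≡0 3∣e = begin
    ∑[ u < n ] [ degree F u ]₃                     ≡⟨ sum-cong-≗ (λ u → *-identityʳ [ degree F u ]₃) ⟨
    ∑[ u < n ] ([ degree F u ]₃ * 1F)                ≡⟨ handshake (λ _ → 1F) ⟨
    sumₗ (map (λ _ → 1F + 1F) (edges F))           ≡⟨ sumₗ-const (1F + 1F) (edges F) ⟩
    [ numEdges F ]₃ * (1F + 1F)                    ≡⟨ cong (_* (1F + 1F)) ([]₃-from-% (numEdges F) 3∣e) ⟩
    0F * (1F + 1F)                                 ≡⟨ *-zeroˡ (1F + 1F) ⟩
    0F                                             ∎
    where open ≡-Reasoning

  copyColorSum-by-degrees : ∀ {χ p} → (∀ u v → u ≢ v → χ u v ≡ - (p u + p v)) →
                            ∀ {σ} → Injective _≡_ _≡_ σ →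
                            copyColorSum χ F σ ≡ toℕ (- (∑[ w < n ] ([ degree F w ]₃ * p (σ w))))
  copyColorSum-by-degrees {χ} {p} χ≡ {σ} σ-injective = begin
    copyColorSum χ F σ
      ≡⟨ copyColorSum-as-sumₗ χ F σ ⟩
    toℕ (sumₗ (map (λ e → χ (σ (proj₁ e)) (σ (proj₂ e))) (edges F)))
      ≡⟨ cong toℕ (sumₗ-edges-cong λ u v u≢v → χ≡ (σ u) (σ v) (u≢v ∘ σ-injective)) ⟩
    toℕ (sumₗ (map (λ e → - (p (σ (proj₁ e)) + p (σ (proj₂ e)))) (edges F)))
      ≡⟨ cong toℕ (sumₗ-neg (λ e → p (σ (proj₁ e)) + p (σ (proj₂ e))) (edges F)) ⟩
    toℕ (- sumₗ (map (λ e → p (σ (proj₁ e)) + p (σ (proj₂ e))) (edges F)))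
      ≡⟨ cong (toℕ ∘ -_) (handshake (p ∘ σ)) ⟩
    toℕ (- (∑[ w < n ] ([ degree F w ]₃ * p (σ w))))
      ∎
    where open ≡-Reasoning

-- Rearranging labels

transpose-applyˡ : ∀ {n} (i j : Fin n) → transpose i j ⟨$⟩ʳ i ≡ j
transpose-applyˡ i j rewrite dec-true (i ≟ i) refl = refl

transpose-applyʳ : ∀ {n} (i j : Fin n) → transpose i j ⟨$⟩ʳ j ≡ i
transpose-applyʳ i j with j ≟ i
... | yes j≡i = j≡i
... | no  _   rewrite dec-true (j ≟ j) refl = refl

transpose-apply-other : ∀ {n} {i j k : Fin n} → k ≢ i → k ≢ j → transpose i j ⟨$⟩ʳ k ≡ k
transpose-apply-other {i = i} {j} {k} k≢i k≢j rewrite dec-false (k ≟ i) k≢i | dec-false (k ≟ j) k≢j = refl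

infixl 9 _[_↔_]

_[_↔_] : ∀ {n} → (Fin n → A) → Fin n → Fin n → Fin n → A
ℓ [ u ↔ v ] = ℓ ∘ (transpose u v ⟨$⟩ʳ_)

module _ {n} (ℓ : Fin n → A) where

  [↔]-left : ∀ u v → (ℓ [ u ↔ v ]) u ≡ ℓ v
  [↔]-left u v = cong ℓ (transpose-applyˡ u v)

  [↔]-right : ∀ u v → (ℓ [ u ↔ v ]) v ≡ ℓ u
  [↔]-right u v = cong ℓ (transpose-applyʳ u v)

  [↔]-other : ∀ {u v w} → w ≢ u → w ≢ v → (ℓ [ u ↔ v ]) w ≡ ℓ w
  [↔]-other w≢u w≢v = cong ℓ (transpose-apply-other w≢u w≢v)

module Arrangement {n} (d : Fin n → ℤ₃) (∑d≡0 : ∑[ w < n ] d w ≡ 0F) where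

  weight : (Fin n → ℤ₃) → ℤ₃
  weight ℓ = ∑[ w < n ] (d w * ℓ w)

  record ZeroWeightRearrangement (ℓ : Fin n → ℤ₃) : Set where
    constructor rearrangement
    field
      π        : Permutation′ n
      weight≡0 : weight (ℓ ∘ (π ⟨$⟩ʳ_)) ≡ 0F

  zero-weight : ∀ {ℓ} → weight ℓ ≡ 0F → ZeroWeightRearrangement ℓ
  zero-weight = rearrangement idₚ

  after-transpose : ∀ {ℓ} u v → ZeroWeightRearrangement (ℓ [ u ↔ v ]) → ZeroWeightRearrangement ℓ
  after-transpose u v (rearrangement π w≡0) = rearrangement (π ∘ₚ transpose u v) w≡0

  weight-constant : ∀ {ℓ c} → (∀ x → d x ≢ 0F → ℓ x ≡ c) → weight ℓ ≡ 0F
  weight-constant {ℓ} {c} ℓ≡c = begin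
    ∑[ w < n ] (d w * ℓ w)  ≡⟨ sum-cong-≗ on-support ⟩
    ∑[ w < n ] (d w * c)    ≡⟨ *-distribʳ-sum c d ⟨
    (∑[ w < n ] d w) * c    ≡⟨ cong (_* c) ∑d≡0 ⟩
    0F * c                  ≡⟨ *-zeroˡ c ⟩
    0F                      ∎
    where
    open ≡-Reasoning
    on-support : ∀ w → d w * ℓ w ≡ d w * c
    on-support w with d w ≟ 0F
    ... | no  dw≢0 = cong (d w *_) (ℓ≡c w dw≢0)
    ... | yes dw≡0 rewrite dw≡0 = trans (*-zeroˡ (ℓ w)) (sym (*-zeroˡ c))

  off-label? : ∀ (ℓ : Fin n → ℤ₃) c → (∃ λ x → d x ≢ 0F × ℓ x ≢ c) ⊎ (∀ x → d x ≢ 0F → ℓ x ≡ c)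
  off-label? ℓ c with any? (λ x → ¬? (d x ≟ 0F) ×-dec ¬? (ℓ x ≟ c))
  ... | yes off = inj₁ off
  ... | no none = inj₂ λ x dx≢0 → decidable-stable (ℓ x ≟ c) λ ℓx≢c → none (x , dx≢0 , ℓx≢c)

  weight-change : (Fin n → ℤ₃) → Fin n → Fin n → ℤ₃
  weight-change ℓ u v = (d u - d v) * (ℓ v - ℓ u)

  weight-transpose : ∀ ℓ {u v} → u ≢ v → weight (ℓ [ u ↔ v ]) ≡ weight ℓ + weight-change ℓ u v
  weight-transpose ℓ {u} {v} u≢v = begin
    ∑[ w < n ] (d w * ℓ′ w)                             ≡⟨ sum-cong-≗ split ⟩
    ∑[ w < n ] (d w * ℓ w + g w)                        ≡⟨ ∑-distrib-+ (λ w → d w * ℓ w) g ⟩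
    weight ℓ + ∑[ w < n ] g w                           ≡⟨ cong (weight ℓ +_) (∑-pair u≢v g-off) ⟩
    weight ℓ + (g u + g v)                              ≡⟨ cong (weight ℓ +_) (cong₂ _+_ g-u g-v) ⟩
    weight ℓ + (d u * (ℓ v - ℓ u) + d v * (ℓ u - ℓ v))
      ≡⟨ cong (weight ℓ +_) (a*[y-x]+b*[x-y]≡[a-b]*[y-x] (d u) (d v) (ℓ u) (ℓ v)) ⟩
    weight ℓ + weight-change ℓ u v                      ∎
    where
    open ≡-Reasoning
    ℓ′ : Fin n → ℤ₃
    ℓ′ = ℓ [ u ↔ v ]
    g : Fin n → ℤ₃
    g w = d w * (ℓ′ w - ℓ w)
    split : ∀ w → d w * ℓ′ w ≡ d w * ℓ w + g w
    split w = trans (cong (d w *_) (sym (y+[x-y]≡x (ℓ′ w) (ℓ w)))) (distribˡ (d w) (ℓ w) (ℓ′ w - ℓ w))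
    g-off : ∀ w → w ≢ u → w ≢ v → g w ≡ 0F
    g-off w w≢u w≢v = begin
      d w * (ℓ′ w - ℓ w)  ≡⟨ cong (λ x → d w * (x - ℓ w)) ([↔]-other ℓ w≢u w≢v) ⟩
      d w * (ℓ w - ℓ w)   ≡⟨ cong (d w *_) (x-x≡0 (ℓ w)) ⟩
      d w * 0F            ≡⟨ zeroʳ (d w) ⟩
      0F                  ∎
    g-u : g u ≡ d u * (ℓ v - ℓ u)
    g-u = cong (λ x → d u * (x - ℓ u)) ([↔]-left ℓ u v)
    g-v : g v ≡ d v * (ℓ u - ℓ v)
    g-v = cong (λ x → d v * (x - ℓ v)) ([↔]-right ℓ u v)

  record Exchange (ℓ : Fin n → ℤ₃) (u v : Fin n) : Set where
    constructor exchange
    field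
      degrees-differ : d u ≢ d v
      labels-differ  : ℓ u ≢ ℓ v

  module _ {ℓ : Fin n → ℤ₃} {u v : Fin n} (uv : Exchange ℓ u v) where
    open Exchange uv

    exchange-distinct : u ≢ v
    exchange-distinct = labels-differ ∘ cong ℓ

    weight-change-nonzero : weight-change ℓ u v ≢ 0F
    weight-change-nonzero = x≢0∧y≢0⇒x*y≢0 (x≢y⇒x-y≢0 degrees-differ) (x≢y⇒x-y≢0 (labels-differ ∘ sym))

    by-exchange : weight ℓ + weight-change ℓ u v ≡ 0F → ZeroWeightRearrangement ℓ
    by-exchange w≡0 = after-transpose u v (zero-weight (trans (weight-transpose ℓ exchange-distinct) w≡0))

  disjoint-exchanges : ∀ {ℓ a x b y} → a ≢ b → a ≢ y → x ≢ b → x ≢ y →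
                       Exchange ℓ a x → Exchange ℓ b y → ZeroWeightRearrangement ℓ
  disjoint-exchanges {ℓ} {a} {x} {b} {y} a≢b a≢y x≢b x≢y ax by =
    [ zero-weight , [ by-exchange ax , [ by-exchange by , by-both ]′ ]′ ]′
      (cover-by-two-and-sum (weight ℓ) (weight-change-nonzero ax) (weight-change-nonzero by))
    where
    b-fixed : (ℓ [ a ↔ x ]) b ≡ ℓ b
    b-fixed = [↔]-other ℓ (a≢b ∘ sym) (x≢b ∘ sym)
    y-fixed : (ℓ [ a ↔ x ]) y ≡ ℓ y
    y-fixed = [↔]-other ℓ (a≢y ∘ sym) (x≢y ∘ sym)
    by′ : Exchange (ℓ [ a ↔ x ]) b y
    by′ = exchange (Exchange.degrees-differ by)
                   (λ eq → Exchange.labels-differ by (trans (sym b-fixed) (trans eq y-fixed)))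
    by-both : weight ℓ + weight-change ℓ a x + weight-change ℓ b y ≡ 0F → ZeroWeightRearrangement ℓ
    by-both w≡0 = after-transpose a x (by-exchange by′ (trans
      (cong₂ _+_ (weight-transpose ℓ (exchange-distinct ax))
                 (cong₂ (λ p q → (d b - d y) * (q - p)) b-fixed y-fixed))
      w≡0))

  ≢-by-degree : ∀ {u v} → d u ≢ d v → u ≢ v
  ≢-by-degree du≢dv = du≢dv ∘ cong d

  zero≢nonzero : ∀ {u v} → d u ≡ 0F → d v ≢ 0F → d u ≢ d v
  zero≢nonzero du≡0 dv≢0 du≡dv = dv≢0 (trans (sym du≡dv) du≡0)

  zero-vertex≢ : ∀ {u v} → d u ≡ 0F → d v ≢ 0F → u ≢ v
  zero-vertex≢ du≡0 dv≢0 = ≢-by-degree (zero≢nonzero du≡0 dv≢0)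

  zero-exchange : ∀ {ℓ u v} → d u ≡ 0F → d v ≢ 0F → ℓ u ≢ ℓ v → Exchange ℓ u v
  zero-exchange du≡0 dv≢0 = exchange (zero≢nonzero du≡0 dv≢0)

  odd-label-out : ∀ {ℓ u v w} → d u ≢ d v → d u ≢ d w → d v ≢ d w → ℓ u ≡ ℓ v → ℓ u ≢ ℓ w →
                  ZeroWeightRearrangement ℓ
  odd-label-out {ℓ} {u} {v} {w} du≢dv du≢dw dv≢dw ℓu≡ℓv ℓu≢ℓw =
    [ zero-weight , [ by-exchange uw , by-exchange vw ]′ ]′
      (cover-by-two (weight ℓ) (weight-change-nonzero uw) (weight-change-nonzero vw) changes-differ)
    where
    uw : Exchange ℓ u w
    uw = exchange du≢dw ℓu≢ℓw
    vw : Exchange ℓ v w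
    vw = exchange dv≢dw (ℓu≢ℓw ∘ trans ℓu≡ℓv)
    changes-differ : weight-change ℓ u w ≢ weight-change ℓ v w
    changes-differ eq = *-cancelʳ-≢ (x≢y⇒x-y≢0 (ℓu≢ℓw ∘ sym)) (-‿cancelʳ-≢ du≢dv)
                          (trans eq (cong (λ x → (d v - d w) * (ℓ w - x)) (sym ℓu≡ℓv)))

  two-equal-labels : ∀ {ℓ a b c} → d a ≢ d b → d a ≢ d c → d b ≢ d c → ℓ a ≡ ℓ b →
                     ZeroWeightRearrangement ℓ
  two-equal-labels {ℓ} {a} {b} {c} da≢db da≢dc db≢dc ℓa≡ℓb with off-label? ℓ (ℓ a)
  ... | inj₂ ℓ≡ℓa         = zero-weight (weight-constant ℓ≡ℓa)
  ... | inj₁ (z , _ , ℓz≢ℓa) =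
    -- moving z's label onto c makes c the odd one out
    after-transpose z c (odd-label-out da≢db da≢dc db≢dc
      (trans ℓ′a≡ℓa (trans ℓa≡ℓb (sym ℓ′b≡ℓb)))
      (λ ℓ′a≡ℓ′c → ℓz≢ℓa (trans (sym ([↔]-right ℓ z c)) (trans (sym ℓ′a≡ℓ′c) ℓ′a≡ℓa))))
    where
    ℓ′a≡ℓa : (ℓ [ z ↔ c ]) a ≡ ℓ a
    ℓ′a≡ℓa = [↔]-other ℓ (λ a≡z → ℓz≢ℓa (cong ℓ (sym a≡z))) (≢-by-degree da≢dc)
    ℓ′b≡ℓb : (ℓ [ z ↔ c ]) b ≡ ℓ b
    ℓ′b≡ℓb = [↔]-other ℓ (λ b≡z → ℓz≢ℓa (trans (cong ℓ (sym b≡z)) (sym ℓa≡ℓb))) (≢-by-degree db≢dc)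

  three-distinct-labels : ∀ {ℓ a b c y} → d a ≢ d b → d a ≢ d c → d b ≢ d c →
                          y ≢ a → y ≢ b → y ≢ c → ℓ a ≢ ℓ b → ℓ a ≢ ℓ c → ℓ b ≢ ℓ c →
                          ZeroWeightRearrangement ℓ
  three-distinct-labels {ℓ} {a} {b} {c} {y} da≢db da≢dc db≢dc y≢a y≢b y≢c ℓa≢ℓb ℓa≢ℓc ℓb≢ℓc
    with distinct-exhaust ℓa≢ℓb ℓa≢ℓc ℓb≢ℓc (ℓ y)
  ... | inj₁ ℓy≡ℓa = after-transpose y b (two-equal-labels da≢db da≢dc db≢dc
    (trans ([↔]-other ℓ (y≢a ∘ sym) (≢-by-degree da≢db)) (trans (sym ℓy≡ℓa) (sym ([↔]-right ℓ y b)))))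
  ... | inj₂ (inj₁ ℓy≡ℓb) = after-transpose y a (two-equal-labels da≢db da≢dc db≢dc
    (trans ([↔]-right ℓ y a) (trans ℓy≡ℓb (sym ([↔]-other ℓ (y≢b ∘ sym) (≢-by-degree da≢db ∘ sym))))))
  ... | inj₂ (inj₂ ℓy≡ℓc) = after-transpose y a (two-equal-labels da≢dc da≢db (db≢dc ∘ sym)
    (trans ([↔]-right ℓ y a) (trans ℓy≡ℓc (sym ([↔]-other ℓ (y≢c ∘ sym) (≢-by-degree da≢dc ∘ sym))))))

  three-distinct-degrees : ∀ {a b c} → d a ≢ d b → d a ≢ d c → d b ≢ d c →
                           (∃ λ y → y ≢ a × y ≢ b × y ≢ c) → ∀ ℓ → ZeroWeightRearrangement ℓ
  three-distinct-degrees {a} {b} {c} da≢db da≢dc db≢dc (y , y≢a , y≢b , y≢c) ℓ with ℓ a ≟ ℓ b | ℓ a ≟ ℓ c | ℓ b ≟ ℓ c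
  ... | yes ℓa≡ℓb | _         | _         = two-equal-labels da≢db da≢dc db≢dc ℓa≡ℓb
  ... | _         | yes ℓa≡ℓc | _         = two-equal-labels da≢dc da≢db (db≢dc ∘ sym) ℓa≡ℓc
  ... | _         | _         | yes ℓb≡ℓc = two-equal-labels db≢dc (da≢db ∘ sym) (da≢dc ∘ sym) ℓb≡ℓc
  ... | no ℓa≢ℓb  | no ℓa≢ℓc  | no ℓb≢ℓc  =
    three-distinct-labels da≢db da≢dc db≢dc y≢a y≢b y≢c ℓa≢ℓb ℓa≢ℓc ℓb≢ℓc

  two-zeros-two-off-label : ∀ {ℓ a b x y} → a ≢ b → d a ≡ 0F → d b ≡ 0F → x ≢ y →
                            d x ≢ 0F → d y ≢ 0F → ℓ x ≢ ℓ a → ℓ y ≢ ℓ a → ZeroWeightRearrangement ℓ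
  two-zeros-two-off-label {ℓ} {a} {b} {x} {y} a≢b da≡0 db≡0 x≢y dx≢0 dy≢0 ℓx≢ℓa ℓy≢ℓa
    with ℓ b ≟ ℓ y | ℓ b ≟ ℓ x
  ... | no ℓb≢ℓy | _ =
    disjoint-exchanges a≢b (zero-vertex≢ da≡0 dy≢0) (zero-vertex≢ db≡0 dx≢0 ∘ sym) x≢y
      (zero-exchange da≡0 dx≢0 (ℓx≢ℓa ∘ sym)) (zero-exchange db≡0 dy≢0 ℓb≢ℓy)
  ... | yes _ | no ℓb≢ℓx =
    disjoint-exchanges a≢b (zero-vertex≢ da≡0 dx≢0) (zero-vertex≢ db≡0 dy≢0 ∘ sym) (x≢y ∘ sym)
      (zero-exchange da≡0 dy≢0 (ℓy≢ℓa ∘ sym)) (zero-exchange db≡0 dx≢0 ℓb≢ℓx)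
  ... | yes _ | yes ℓb≡ℓx with off-label? ℓ (ℓ b)
  ...   | inj₂ ℓ≡ℓb = zero-weight (weight-constant ℓ≡ℓb)
  ...   | inj₁ (z , dz≢0 , ℓz≢ℓb) =
    disjoint-exchanges a≢b (zero-vertex≢ da≡0 dz≢0) (zero-vertex≢ db≡0 dx≢0 ∘ sym)
      (λ x≡z → ℓz≢ℓb (trans (cong ℓ (sym x≡z)) (sym ℓb≡ℓx)))
      (zero-exchange da≡0 dx≢0 (ℓx≢ℓa ∘ sym)) (zero-exchange db≡0 dz≢0 (ℓz≢ℓb ∘ sym))

  two-zero-degrees : ∀ {a b} → a ≢ b → d a ≡ 0F → d b ≡ 0F → ∀ ℓ → ZeroWeightRearrangement ℓ
  two-zero-degrees {a} {b} a≢b da≡0 db≡0 ℓ with off-label? ℓ (ℓ a)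
  ... | inj₂ ℓ≡ℓa = zero-weight (weight-constant ℓ≡ℓa)
  ... | inj₁ (x , dx≢0 , ℓx≢ℓa) with off-label? (ℓ [ a ↔ x ]) (ℓ a)
  ...   | inj₂ ℓ′≡ℓa = after-transpose a x (zero-weight (weight-constant ℓ′≡ℓa))
  ...   | inj₁ (y , dy≢0 , ℓ′y≢ℓa) =
    two-zeros-two-off-label a≢b da≡0 db≡0 x≢y dx≢0 dy≢0 ℓx≢ℓa
      (ℓ′y≢ℓa ∘ trans ([↔]-other ℓ (zero-vertex≢ da≡0 dy≢0 ∘ sym) (x≢y ∘ sym)))
    where
    x≢y : x ≢ y
    x≢y x≡y = ℓ′y≢ℓa (subst (λ w → (ℓ [ a ↔ x ]) w ≡ ℓ a) x≡y ([↔]-right ℓ a x))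

length-filterᵇ : ∀ (p : A → Bool) xs → length (filterᵇ p xs) ≡ sumℕ (map (λ x → if p x then 1 else 0) xs)
length-filterᵇ p []       = refl
length-filterᵇ p (x ∷ xs) with p x
... | true  = cong suc (length-filterᵇ p xs)
... | false = length-filterᵇ p xs

-- On three vertices, 3 ∣ e(F) forces F to be empty or a triangle.
degrees-on-three : (F : Graph 3) → numEdges F % 3 ≡ 0 →
                   degree F 0F % 3 ≢ 1 × degree F 1F % 3 ≢ 1 × degree F 2F % 3 ≢ 1
degrees-on-three F
  rewrite length-filterᵇ (λ e → (toℕ (proj₁ e) <ᵇ toℕ (proj₂ e)) ∧ adj F (proj₁ e) (proj₂ e)) (pairs 3)
        | length-filterᵇ (adj F 0F) (allFin 3)
        | length-filterᵇ (adj F 1F) (allFin 3)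
        | length-filterᵇ (adj F 2F) (allFin 3)
  with adj F 0F 0F | loopless F 0F | adj F 1F 1F | loopless F 1F | adj F 2F 2F | loopless F 2F
     | adj F 1F 0F | adj-sym F 1F 0F | adj F 2F 0F | adj-sym F 2F 0F | adj F 2F 1F | adj-sym F 2F 1F
... | _ | refl | _ | refl | _ | refl | _ | refl | _ | refl | _ | refl
  with adj F 0F 1F | adj F 0F 2F | adj F 1F 2F
... | false | false | false = λ _ → (λ ()) , (λ ()) , (λ ())
... | true  | true  | true  = λ _ → (λ ()) , (λ ()) , (λ ())
... | true  | false | false = λ ()
... | false | true  | false = λ ()
... | false | false | true  = λ ()
... | true  | true  | false = λ ()
... | true  | false | true  = λ ()
... | false | true  | true  = λ ()

no-degree-one-on-three : ∀ {n} (F : Graph n) → n ≡ 3 → numEdges F % 3 ≡ 0 → ∀ v → degree F v % 3 ≢ 1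
no-degree-one-on-three F refl 3∣e 0F = proj₁ (degrees-on-three F 3∣e)
no-degree-one-on-three F refl 3∣e 1F = proj₁ (proj₂ (degrees-on-three F 3∣e))
no-degree-one-on-three F refl 3∣e 2F = proj₂ (proj₂ (degrees-on-three F 3∣e))

fourth-vertex : ∀ {n} → n ≢ 3 → {a b c : Fin n} → a ≢ b → a ≢ c → b ≢ c → ∃ λ y → y ≢ a × y ≢ b × y ≢ c
fourth-vertex {n} n≢3 {a} {b} {c} a≢b a≢c b≢c with any? (λ y → ¬? (y ≟ a) ×-dec ¬? (y ≟ b) ×-dec ¬? (y ≟ c))
... | yes fresh = fresh
... | no ¬fresh = contradiction (≤-antisym (injective⇒≤ index-injective) (injective⇒≤ pick-injective)) n≢3
  where
  pick : Fin 3 → Fin n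
  pick 0F = a
  pick 1F = b
  pick 2F = c

  pick-injective : Injective _≡_ _≡_ pick
  pick-injective {0F} {0F} _   = refl
  pick-injective {1F} {1F} _   = refl
  pick-injective {2F} {2F} _   = refl
  pick-injective {0F} {1F} a≡b = contradiction a≡b a≢b
  pick-injective {0F} {2F} a≡c = contradiction a≡c a≢c
  pick-injective {1F} {0F} b≡a = contradiction (sym b≡a) a≢b
  pick-injective {1F} {2F} b≡c = contradiction b≡c b≢c
  pick-injective {2F} {0F} c≡a = contradiction (sym c≡a) a≢c
  pick-injective {2F} {1F} c≡b = contradiction (sym c≡b) b≢c

  index : Fin n → Fin 3
  index y with y ≟ a | y ≟ b
  ... | yes _ | _     = 0F
  ... | no _  | yes _ = 1F
  ... | no _  | no _  = 2F

  pick-index : ∀ y → pick (index y) ≡ y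
  pick-index y with y ≟ a | y ≟ b | y ≟ c
  ... | yes y≡a | _       | _       = sym y≡a
  ... | no _    | yes y≡b | _       = sym y≡b
  ... | no _    | no _    | yes y≡c = sym y≡c
  ... | no y≢a  | no y≢b  | no y≢c  = contradiction (y , y≢a , y≢b , y≢c) ¬fresh

  index-injective : Injective _≡_ _≡_ index
  index-injective {x} {y} eq = trans (sym (pick-index x)) (trans (cong pick eq) (pick-index y))

module _ {n} (F : Graph n) (3∣e : numEdges F % 3 ≡ 0) where
  open Arrangement (λ w → [ degree F w ]₃) (degree-sum≡0 F 3∣e)

  zero-weight-rearrangement :
    ((∃[ a ] degree F a % 3 ≡ 0) × (∃[ b ] degree F b % 3 ≡ 1) × (∃[ c ] degree F c % 3 ≡ 2))
    ⊎ (∃[ a ] ∃[ b ] (a ≢ b × degree F a % 3 ≡ 0 × degree F b % 3 ≡ 0)) →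
    ∀ ℓ → ZeroWeightRearrangement ℓ
  zero-weight-rearrangement (inj₂ (a , b , a≢b , a₀ , b₀)) =
    two-zero-degrees a≢b ([]₃-from-% (degree F a) a₀) ([]₃-from-% (degree F b) b₀)
  zero-weight-rearrangement (inj₁ ((a , a₀) , (b , b₁) , (c , c₂))) with n ℕ.≟ 3
  ... | yes n≡3 = contradiction b₁ (no-degree-one-on-three F n≡3 3∣e b)
  ... | no  n≢3 = three-distinct-degrees da≢db da≢dc db≢dc
                    (fourth-vertex n≢3 (≢-by-degree da≢db) (≢-by-degree da≢dc) (≢-by-degree db≢dc))
    where
    da≡0 : [ degree F a ]₃ ≡ 0F
    da≡0 = []₃-from-% (degree F a) a₀
    db≡1 : [ degree F b ]₃ ≡ 1F
    db≡1 = []₃-from-% (degree F b) b₁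
    dc≡2 : [ degree F c ]₃ ≡ 2F
    dc≡2 = []₃-from-% (degree F c) c₂
    da≢db : [ degree F a ]₃ ≢ [ degree F b ]₃
    da≢db eq with trans (sym da≡0) (trans eq db≡1)
    ... | ()
    da≢dc : [ degree F a ]₃ ≢ [ degree F c ]₃
    da≢dc eq with trans (sym da≡0) (trans eq dc≡2)
    ... | ()
    db≢dc : [ degree F b ]₃ ≢ [ degree F c ]₃
    db≢dc eq with trans (sym db≡1) (trans eq dc≡2)
    ... | ()

proposition4p6 : (n : ℕ) (χ : Coloring n) → IsCC χ →
    (F : Graph n) → IsForest F → numEdges F % 3 ≡ 0 →
    ((∃[ a ] degree F a % 3 ≡ 0) × (∃[ b ] degree F b % 3 ≡ 1) × (∃[ c ] degree F c % 3 ≡ 2))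
      ⊎ (∃[ a ] ∃[ b ] (a ≢ b × degree F a % 3 ≡ 0 × degree F b % 3 ≡ 0)) →
    Σ (Fin n → Fin n) λ σ → Injective _≡_ _≡_ σ × copyColorSum χ F σ ≡ 0
proposition4p6 n χ χ-cc F _ 3∣e residues = σ , σ-injective , (begin
  copyColorSum χ F σ      ≡⟨ copyColorSum-by-degrees F χ-by-parts σ-injective ⟩
  toℕ (- weight (p ∘ σ))  ≡⟨ cong (toℕ ∘ -_) weight≡0 ⟩
  toℕ (- 0F)              ≡⟨ cong toℕ -0≡0 ⟩
  0                       ∎)
  where
  open ≡-Reasoning
  open Arrangement (λ w → [ degree F w ]₃) (degree-sum≡0 F 3∣e) using (weight; module ZeroWeightRearrangement)
  p : Fin n → ℤ₃
  p = proj₁ (cc-colour-by-parts χ-cc)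
  χ-by-parts : ∀ u v → u ≢ v → χ u v ≡ - (p u + p v)
  χ-by-parts = proj₂ (cc-colour-by-parts χ-cc)
  open ZeroWeightRearrangement (zero-weight-rearrangement F 3∣e residues p)
  σ : Fin n → Fin n
  σ = π ⟨$⟩ʳ_
  σ-injective : Injective _≡_ _≡_ σ
  σ-injective = Injection.injective (↔⇒↣ π)
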